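{- Let $G$ be a graph of order $n$ belonging to the family $\mathcal{G}$. Then both the domination number of $G$ and the isolation number of $G$ equal $n/3$.
   Context: All graphs are finite and simple. For $X\subseteq V(G)$, $N[X]$ is the closed neighborhood of $X$. An isolating set of $G$ is a set $X$ such that $G-N[X]$ has no edge; the isolation number is the minimum cardinality of an isolating set. The domination number is the minimum cardinality of a set $X$ with $N[X]=V(G)$. The family $\mathcal{G}$ consists of the graphs constructed as follows: take a connected graph (the base graph, with at least one vertex); for each vertex $h$ of the base graph (called a hook), add a new disjoint copy $P_h$ of either $K_2$ or $C_5$ (the pendant of $h$), and join $h$ to some vertices of $P_h$: if $P_h$ is $K_2$, join $h$ to one or to both vertices of $P_h$; if $P_h$ is $C_5$, join $h$ to exactly one vertex, or to any two vertices, or to three consecutive vertices of the $5$-cycle. There are no other edges. -}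

module Defs where

open import Data.Nat using (ℕ; zero; suc; _+_; _*_; _≤_)
open import Data.Bool using (Bool; true; false; _∨_)
open import Data.Fin using (Fin; zero; suc; _≟_)
open import Data.Fin.Subset using (Subset; _∈_; ∣_∣; ⁅_⁆; _∪_)
open import Data.Product using (Σ; ∃; _×_; _,_)
open import Data.Sum using (_⊎_)
open import Relation.Binary.PropositionalEquality using (_≡_)
open import Relation.Nullary.Decidable using (⌊_⌋)
open import Function.Bundles using (_↔_; _⇔_)

record Graph (n : ℕ) : Set where
  field
    Adj    : Fin n → Fin n → Bool
    sym    : ∀ u v → Adj u v ≡ Adj v u
    irrefl : ∀ v → Adj v v ≡ false
open Graph public

module _ {n : ℕ} (G : Graph n) where

  InClosedNbhd : Subset n → Fin n → Set
  InClosedNbhd X v = v ∈ X ⊎ (∃ λ u → u ∈ X × Adj G u v ≡ true)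

  Dominating : Subset n → Set
  Dominating X = ∀ v → InClosedNbhd X v

  -- G - N[X] has no edge: every edge has an endpoint in N[X]
  Isolating : Subset n → Set
  Isolating X = ∀ u v → Adj G u v ≡ true → InClosedNbhd X u ⊎ InClosedNbhd X v

  IsMinCard : (Subset n → Set) → ℕ → Set
  IsMinCard P k = (∃ λ X → P X × ∣ X ∣ ≡ k) × (∀ X → P X → k ≤ ∣ X ∣)

  IsDominationNumber : ℕ → Set
  IsDominationNumber = IsMinCard Dominating

  IsIsolationNumber : ℕ → Set
  IsIsolationNumber = IsMinCard Isolating

  data Reach : Fin n → Fin n → Set where
    here : ∀ {v} → Reach v v
    step : ∀ {u w v} → Adj G u w ≡ true → Reach w v → Reach u v

  Connected : Set
  Connected = ∀ u v → Reach u v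

-- Pendants: K₂ (vertices 0,1) or C₅ (vertices 0..4, edges i ~ i+1 mod 5)

data PType : Set where
  k2 c5 : PType

psize : PType → ℕ
psize k2 = 2
psize c5 = 5

cyc : Fin 5 → Fin 5
cyc zero = suc zero
cyc (suc zero) = suc (suc zero)
cyc (suc (suc zero)) = suc (suc (suc zero))
cyc (suc (suc (suc zero))) = suc (suc (suc (suc zero)))
cyc (suc (suc (suc (suc zero)))) = zero

PAdj : (p : PType) → Fin (psize p) → Fin (psize p) → Bool
PAdj k2 zero (suc zero) = true
PAdj k2 (suc zero) zero = true
PAdj k2 _ _ = false
PAdj c5 i j = ⌊ j ≟ cyc i ⌋ ∨ ⌊ i ≟ cyc j ⌋

-- allowed sets of pendant vertices joined to the hook
ValidAttach : (p : PType) → Subset (psize p) → Set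
ValidAttach k2 S = 1 ≤ ∣ S ∣
ValidAttach c5 S = ∣ S ∣ ≡ 1 ⊎ ∣ S ∣ ≡ 2
                 ⊎ (∃ λ i → S ≡ ⁅ i ⁆ ∪ ⁅ cyc i ⁆ ∪ ⁅ cyc (cyc i) ⁆)

record Construction (m : ℕ) : Set where
  field
    base      : Graph m
    nonempty  : 1 ≤ m
    connected : Connected base
    ptype     : Fin m → PType
    attach    : (h : Fin m) → Subset (psize (ptype h))
    valid     : (h : Fin m) → ValidAttach (ptype h) (attach h)
open Construction public

module _ {m : ℕ} (C : Construction m) where

  data CV : Set where
    hook : Fin m → CV
    pend : (h : Fin m) → Fin (psize (ptype C h)) → CV

  data CAdj : CV → CV → Set where
    base-edge : ∀ {h h'} → Adj (base C) h h' ≡ true → CAdj (hook h) (hook h')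
    hook-pend : ∀ {h i} → i ∈ attach C h → CAdj (hook h) (pend h i)
    pend-hook : ∀ {h i} → i ∈ attach C h → CAdj (pend h i) (hook h)
    pend-pend : ∀ {h i j} → PAdj (ptype C h) i j ≡ true → CAdj (pend h i) (pend h j)

In𝒢 : {n : ℕ} → Graph n → Set
In𝒢 {n} G = ∃ λ m → Σ (Construction m) λ C → Σ (Fin n ↔ CV C) λ f →
  ∀ u v → (Adj G u v ≡ true) ⇔ CAdj C (Inverse.to f u) (Inverse.to f v)
  where open import Function.Bundles using (Inverse)

{-# OPTIONS --safe #-}
-- Every hook together with its pendant forms a block of 3·w vertices, w = 1 for K₂ and w = 2
-- for C₅, and no vertex outside the block is adjacent to its pendant. Hence an isolating set
-- meets every block, and meets a C₅-block at least twice: a single vertex of the block leaves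
-- an edge of the 5-cycle outside its closed neighbourhood, since the hook sees one, two or
-- three consecutive cycle vertices and a cycle vertex sees three consecutive ones. Conversely,
-- in every block a neighbour a of the hook, together with the cycle vertex at distance two
-- from a for C₅, dominates the block; these w-sets form a dominating set of size Σ w = n/3,
-- and dominating sets are isolating.
module Submission where

open import Defs hiding (sym)
open import Data.Nat.Properties
  using (_≤?_; +-0-commutativeMonoid; +-*-semiring; +-assoc; +-mono-≤; ≤-trans; ≤-reflexive;
         module ≤-Reasoning)
  renaming (_≟_ to _≟ℕ_)
open import Algebra.Properties.CommutativeMonoid.Sum +-0-commutativeMonoid
  using (sum; sum-syntax; sum-cong-≗; sum-permute)
open import Algebra.Properties.Semiring.Sum +-*-semiring using (*-distribˡ-sum)
open import Data.Bool.Base using (true; false; if_then_else_)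
open import Data.Bool.Properties using () renaming (_≟_ to _≟ᵇ_)
open import Data.Fin.Base using (Fin; zero; suc; _↑ˡ_; _↑ʳ_; splitAt)
open import Data.Fin.Permutation using (↔⇒≡)
open import Data.Fin.Properties
  using (_≟_; all?; any?; splitAt-↑ˡ; splitAt-↑ʳ; splitAt⁻¹-↑ˡ; splitAt⁻¹-↑ʳ)
open import Data.Fin.Subset using (Subset; _∈_; _∉_; ∣_∣; ⁅_⁆; _∪_; inside; outside; Nonempty)
open import Data.Fin.Subset.Properties
  using (_∈?_; anySubset?; x∈⁅x⁆; ∣⁅x⁆∣≡1; x∈p∪q⁺; x∈p⇒∣p-x∣<∣p∣; x∈p∧x≢y⇒x∈p-y)
open import Data.Nat.Base using (ℕ; zero; suc; _+_; _*_; _≤_; z≤n; s≤s)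
open import Data.Product.Base using (Σ; ∃; _×_; _,_; proj₁; proj₂; uncurry)
import Data.Product.Base as Product
open import Data.Sum.Base using (_⊎_; inj₁; inj₂; [_,_]′)
open import Data.Vec.Base using ([]; _∷_; lookup; tabulate; here; there)
open import Data.Vec.Properties
  using (lookup∘tabulate; tabulate∘lookup; tabulate-cong; []=⇒lookup; lookup⇒[]=)
open import Function.Base using (_∘_; id)
open import Function.Bundles using (_↔_; _⇔_; Inverse; mk↔ₛ′; Equivalence)
open import Function.Properties.Inverse using (↔-trans; ↔-sym)
open import Relation.Binary.PropositionalEquality
  using (_≡_; _≢_; refl; sym; trans; cong; subst; subst₂; module ≡-Reasoning)
open import Relation.Nullary.Decidable
  using (Dec; ¬?; _×-dec_; _⊎-dec_; from-yes; from-no; decidable-stable)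
open import Relation.Nullary.Negation using (¬_)

∑-↑ : ∀ a {b} (g : Fin (a + b) → ℕ) → sum g ≡ sum (g ∘ (_↑ˡ b)) + sum (g ∘ (a ↑ʳ_))
∑-↑ zero    g = refl
∑-↑ (suc a) g = trans (cong (g zero +_) (∑-↑ a (g ∘ suc))) (sym (+-assoc (g zero) _ _))

∑-mono-≤ : ∀ {k} {f g : Fin k → ℕ} → (∀ i → f i ≤ g i) → sum f ≤ sum g
∑-mono-≤ {zero}  f≤g = z≤n
∑-mono-≤ {suc k} f≤g = +-mono-≤ (f≤g zero) (∑-mono-≤ (f≤g ∘ suc))

indicator : ∀ {k} → Subset k → Fin k → ℕ
indicator p i = if lookup p i then 1 else 0

∣p∣≡∑indicator : ∀ {k} (p : Subset k) → ∣ p ∣ ≡ sum (indicator p)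
∣p∣≡∑indicator []          = refl
∣p∣≡∑indicator (true  ∷ p) = cong suc (∣p∣≡∑indicator p)
∣p∣≡∑indicator (false ∷ p) = ∣p∣≡∑indicator p

x∈p⇒1≤∣p∣ : ∀ {k} {p : Subset k} {x} → x ∈ p → 1 ≤ ∣ p ∣
x∈p⇒1≤∣p∣ x∈p = ≤-trans (s≤s z≤n) (x∈p⇒∣p-x∣<∣p∣ x∈p)

x,y∈p⇒2≤∣p∣ : ∀ {k} {p : Subset k} {x y} → x ∈ p → y ∈ p → x ≢ y → 2 ≤ ∣ p ∣
x,y∈p⇒2≤∣p∣ x∈p y∈p x≢y =
  ≤-trans (s≤s (x∈p⇒1≤∣p∣ (x∈p∧x≢y⇒x∈p-y y∈p (x≢y ∘ sym)))) (x∈p⇒∣p-x∣<∣p∣ x∈p)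

1≤∣p∣⇒Nonempty : ∀ {k} {p : Subset k} → 1 ≤ ∣ p ∣ → Nonempty p
1≤∣p∣⇒Nonempty {p = inside  ∷ p} _     = zero , here
1≤∣p∣⇒Nonempty {p = outside ∷ p} 1≤∣p∣ = Product.map suc there (1≤∣p∣⇒Nonempty 1≤∣p∣)

inject∑ : ∀ {m} (size : Fin m → ℕ) → Σ (Fin m) (Fin ∘ size) → Fin (sum size)
inject∑ size (zero  , k) = k ↑ˡ _
inject∑ size (suc h , k) = size zero ↑ʳ inject∑ (size ∘ suc) (h , k)

split∑ : ∀ {m} (size : Fin m → ℕ) → Fin (sum size) → Σ (Fin m) (Fin ∘ size)
split∑ {suc m} size x =
  [ (zero ,_) , Product.map suc id ∘ split∑ (size ∘ suc) ]′ (splitAt (size zero) x)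

split∑-inject∑ : ∀ {m} (size : Fin m → ℕ) hk → split∑ size (inject∑ size hk) ≡ hk
split∑-inject∑ size (zero , k) rewrite splitAt-↑ˡ (size zero) k (sum (size ∘ suc)) = refl
split∑-inject∑ size (suc h , k)
  rewrite splitAt-↑ʳ (size zero) (sum (size ∘ suc)) (inject∑ (size ∘ suc) (h , k))
        | split∑-inject∑ (size ∘ suc) (h , k) = refl

inject∑-split∑ : ∀ {m} (size : Fin m → ℕ) x → inject∑ size (split∑ size x) ≡ x
inject∑-split∑ {suc m} size x with splitAt (size zero) x in eq
... | inj₁ k = splitAt⁻¹-↑ˡ eq
... | inj₂ y = trans (cong (size zero ↑ʳ_) (inject∑-split∑ (size ∘ suc) y)) (splitAt⁻¹-↑ʳ eq)

∑↔Σ : ∀ {m} (size : Fin m → ℕ) → Fin (sum size) ↔ Σ (Fin m) (Fin ∘ size)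
∑↔Σ size = mk↔ₛ′ (split∑ size) (inject∑ size) (split∑-inject∑ size) (inject∑-split∑ size)

∑-inject∑ : ∀ {m} (size : Fin m → ℕ) (g : Fin (sum size) → ℕ) →
            sum g ≡ ∑[ h < m ] ∑[ k < size h ] g (inject∑ size (h , k))
∑-inject∑ {zero}  size g = refl
∑-inject∑ {suc m} size g = trans (∑-↑ (size zero) g)
  (cong (sum (g ∘ (_↑ˡ sum (size ∘ suc))) +_) (∑-inject∑ (size ∘ suc) (g ∘ (size zero ↑ʳ_))))

module Blocks {n m : ℕ} {size : Fin m → ℕ} (β : Fin n ↔ Σ (Fin m) (Fin ∘ size)) where
  open Inverse β using (to; from; strictlyInverseˡ)

  n≡∑size : n ≡ sum size
  n≡∑size = ↔⇒≡ (↔-trans β (↔-sym (∑↔Σ size)))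

  ∑-blocks : (g : Fin n → ℕ) → sum g ≡ ∑[ h < m ] ∑[ k < size h ] g (from (h , k))
  ∑-blocks g = begin
    sum g                         ≡⟨ sum-permute g (↔-trans (∑↔Σ size) (↔-sym β)) ⟩
    sum (g ∘ from ∘ split∑ size)  ≡⟨ ∑-inject∑ size _ ⟩
    ∑[ h < m ] ∑[ k < size h ] g (from (split∑ size (inject∑ size (h , k))))
      ≡⟨ sum-cong-≗ (λ h → sum-cong-≗ (λ k → cong (g ∘ from) (split∑-inject∑ size (h , k)))) ⟩
    ∑[ h < m ] ∑[ k < size h ] g (from (h , k))  ∎
    where open ≡-Reasoning

  restrict : Subset n → (h : Fin m) → Subset (size h)
  restrict X h = tabulate (λ k → lookup X (from (h , k)))

  glue : ((h : Fin m) → Subset (size h)) → Subset n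
  glue L = tabulate (uncurry (λ h → lookup (L h)) ∘ to)

  ∈-restrict : ∀ {X h k} → from (h , k) ∈ X → k ∈ restrict X h
  ∈-restrict {X} {h} {k} x∈X =
    lookup⇒[]= k _ (trans (lookup∘tabulate (λ k → lookup X (from (h , k))) k) ([]=⇒lookup x∈X))

  lookup-glue : ∀ L h k → lookup (glue L) (from (h , k)) ≡ lookup (L h) k
  lookup-glue L h k = trans (lookup∘tabulate (uncurry (λ h → lookup (L h)) ∘ to) (from (h , k)))
                            (cong (uncurry (λ h → lookup (L h))) (strictlyInverseˡ (h , k)))

  ∈-glue : ∀ {L h k} → k ∈ L h → from (h , k) ∈ glue L
  ∈-glue {L} {h} {k} k∈L = lookup⇒[]= _ _ (trans (lookup-glue L h k) ([]=⇒lookup k∈L))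

  restrict-glue : ∀ L h → restrict (glue L) h ≡ L h
  restrict-glue L h = trans (tabulate-cong (lookup-glue L h)) (tabulate∘lookup (L h))

  ∣X∣≡∑∣restrict∣ : ∀ X → ∣ X ∣ ≡ ∑[ h < m ] ∣ restrict X h ∣
  ∣X∣≡∑∣restrict∣ X = begin
    ∣ X ∣                                                  ≡⟨ ∣p∣≡∑indicator X ⟩
    sum (indicator X)                                      ≡⟨ ∑-blocks (indicator X) ⟩
    ∑[ h < m ] ∑[ k < size h ] indicator X (from (h , k))  ≡⟨ sum-cong-≗ (sym ∘ ∣restrict∣) ⟩
    ∑[ h < m ] ∣ restrict X h ∣                            ∎
    where
    open ≡-Reasoning
    ∣restrict∣ : ∀ h → ∣ restrict X h ∣ ≡ ∑[ k < size h ] indicator X (from (h , k))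
    ∣restrict∣ h = trans (∣p∣≡∑indicator (restrict X h)) (sum-cong-≗ (λ k →
      cong (λ b → if b then 1 else 0) (lookup∘tabulate (λ k → lookup X (from (h , k))) k)))

  ∣glue∣ : ∀ L → ∣ glue L ∣ ≡ ∑[ h < m ] ∣ L h ∣
  ∣glue∣ L = trans (∣X∣≡∑∣restrict∣ (glue L)) (sum-cong-≗ (cong ∣_∣ ∘ restrict-glue L))

dominating⇒isolating : ∀ {n} (G : Graph n) {X} → Dominating G X → Isolating G X
dominating⇒isolating G dominating u v _ = inj₁ (dominating u)

weight : PType → ℕ
weight k2 = 1
weight c5 = 2

3*weight≡1+psize : ∀ p → 3 * weight p ≡ suc (psize p)
3*weight≡1+psize k2 = refl
3*weight≡1+psize c5 = refl

PNear : (p : PType) → Fin (psize p) → Fin (psize p) → Set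
PNear p v i = v ≡ i ⊎ PAdj p v i ≡ true

pnear? : ∀ p v i → Dec (PNear p v i)
pnear? p v i = v ≟ i ⊎-dec PAdj p v i ≟ᵇ true

-- A block (a hook with its pendant) has vertex set Fin (1 + psize p): zero is the hook and
-- suc v is pendant vertex v; S is the set of pendant vertices joined to the hook.
Covers : (p : PType) → Subset (psize p) → Fin (suc (psize p)) → Fin (psize p) → Set
Covers p S zero    i = i ∈ S
Covers p S (suc v) i = PNear p v i

BlockIsolating : (p : PType) → Subset (psize p) → Subset (suc (psize p)) → Set
BlockIsolating p S Y =
  ∀ {i j} → PAdj p i j ≡ true → ∃ λ k → k ∈ Y × (Covers p S k i ⊎ Covers p S k j)

c5-adj-cyc : ∀ i → PAdj c5 i (cyc i) ≡ true
c5-adj-cyc = from-yes (all? (λ i → PAdj c5 i (cyc i) ≟ᵇ true))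

UncoveredEdge : Subset 5 → Set
UncoveredEdge S = ∃ λ i → i ∉ S × cyc i ∉ S

uncoveredEdge? : ∀ S → Dec (UncoveredEdge S)
uncoveredEdge? S = any? (λ i → ¬? (i ∈? S) ×-dec ¬? (cyc i ∈? S))

∣S∣≤2⇒uncoveredEdge : ∀ S → ∣ S ∣ ≤ 2 → UncoveredEdge S
∣S∣≤2⇒uncoveredEdge S ∣S∣≤2 = decidable-stable (uncoveredEdge? S) λ no-uncovered-edge →
  from-no (anySubset? (λ S → ∣ S ∣ ≤? 2 ×-dec ¬? (uncoveredEdge? S))) (S , ∣S∣≤2 , no-uncovered-edge)

consecutive⇒uncoveredEdge : ∀ i → UncoveredEdge (⁅ i ⁆ ∪ ⁅ cyc i ⁆ ∪ ⁅ cyc (cyc i) ⁆)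
consecutive⇒uncoveredEdge =
  from-yes (all? (λ i → uncoveredEdge? (⁅ i ⁆ ∪ ⁅ cyc i ⁆ ∪ ⁅ cyc (cyc i) ⁆)))

validAttach-c5⇒uncoveredEdge : ∀ {S} → ValidAttach c5 S → UncoveredEdge S
validAttach-c5⇒uncoveredEdge {S} (inj₁ ∣S∣≡1) =
  ∣S∣≤2⇒uncoveredEdge S (≤-trans (≤-reflexive ∣S∣≡1) (s≤s z≤n))
validAttach-c5⇒uncoveredEdge {S} (inj₂ (inj₁ ∣S∣≡2)) = ∣S∣≤2⇒uncoveredEdge S (≤-reflexive ∣S∣≡2)
validAttach-c5⇒uncoveredEdge (inj₂ (inj₂ (i , refl))) = consecutive⇒uncoveredEdge i

c5-pnear-missesEdge : ∀ v → ∃ λ i → ¬ PNear c5 v i × ¬ PNear c5 v (cyc i)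
c5-pnear-missesEdge =
  from-yes (all? (λ v → any? (λ i → ¬? (pnear? c5 v i) ×-dec ¬? (pnear? c5 v (cyc i)))))

c5-covers-missesEdge : ∀ {S} → ValidAttach c5 S →
                       ∀ k → ∃ λ i → ¬ Covers c5 S k i × ¬ Covers c5 S k (cyc i)
c5-covers-missesEdge valid zero    = validAttach-c5⇒uncoveredEdge valid
c5-covers-missesEdge valid (suc v) = c5-pnear-missesEdge v

blockIsolating⇒weight≤∣Y∣ : ∀ {p S Y} → ValidAttach p S → BlockIsolating p S Y → weight p ≤ ∣ Y ∣
blockIsolating⇒weight≤∣Y∣ {k2} _ isolating with isolating {zero} {suc zero} refl
... | k , k∈Y , _ = x∈p⇒1≤∣p∣ k∈Y
blockIsolating⇒weight≤∣Y∣ {c5} valid isolating with isolating {zero} {suc zero} refl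
... | k , k∈Y , _ with c5-covers-missesEdge valid k
...   | i , ¬covers-i , ¬covers-cyc-i with isolating (c5-adj-cyc i)
...     | k′ , k′∈Y , covers = x,y∈p⇒2≤∣p∣ k∈Y k′∈Y λ { refl → [ ¬covers-i , ¬covers-cyc-i ]′ covers }

pendantDominator : (p : PType) → Fin (psize p) → Subset (psize p)
pendantDominator k2 a = ⁅ a ⁆
pendantDominator c5 a = ⁅ a ⁆ ∪ ⁅ cyc (cyc a) ⁆

a∈pendantDominator : ∀ p a → a ∈ pendantDominator p a
a∈pendantDominator k2 a = x∈⁅x⁆ a
a∈pendantDominator c5 a = x∈p∪q⁺ (inj₁ (x∈⁅x⁆ a))

∣pendantDominator∣ : ∀ p a → ∣ pendantDominator p a ∣ ≡ weight p
∣pendantDominator∣ k2 = ∣⁅x⁆∣≡1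
∣pendantDominator∣ c5 = from-yes (all? (λ a → ∣ pendantDominator c5 a ∣ ≟ℕ 2))

pendantDominator-dominates? : ∀ p → Dec (∀ a j → ∃ λ i → i ∈ pendantDominator p a × PNear p i j)
pendantDominator-dominates? p =
  all? (λ a → all? (λ j → any? (λ i → i ∈? pendantDominator p a ×-dec pnear? p i j)))

pendantDominator-dominates : ∀ p a j → ∃ λ i → i ∈ pendantDominator p a × PNear p i j
pendantDominator-dominates k2 = from-yes (pendantDominator-dominates? k2)
pendantDominator-dominates c5 = from-yes (pendantDominator-dominates? c5)

validAttach⇒Nonempty : ∀ {p S} → ValidAttach p S → Nonempty S
validAttach⇒Nonempty {k2} 1≤∣S∣ = 1≤∣p∣⇒Nonempty 1≤∣S∣
validAttach⇒Nonempty {c5} (inj₁ ∣S∣≡1) = 1≤∣p∣⇒Nonempty (≤-reflexive (sym ∣S∣≡1))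
validAttach⇒Nonempty {c5} (inj₂ (inj₁ ∣S∣≡2)) =
  1≤∣p∣⇒Nonempty (≤-trans (s≤s z≤n) (≤-reflexive (sym ∣S∣≡2)))
validAttach⇒Nonempty {c5} (inj₂ (inj₂ (i , refl))) = i , x∈p∪q⁺ (inj₁ (x∈⁅x⁆ i))

module _ {m : ℕ} (C : Construction m) where

  blockSize : Fin m → ℕ
  blockSize h = suc (psize (ptype C h))

  blockVertex : (h : Fin m) → Fin (blockSize h) → CV C
  blockVertex h zero    = hook h
  blockVertex h (suc v) = pend h v

  blockIndex : CV C → Σ (Fin m) (Fin ∘ blockSize)
  blockIndex (hook h)   = h , zero
  blockIndex (pend h v) = h , suc v

  CV↔blocks : CV C ↔ Σ (Fin m) (Fin ∘ blockSize)
  CV↔blocks = mk↔ₛ′ blockIndex (uncurry blockVertex) index-vertex vertex-index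
    where
    index-vertex : ∀ hk → blockIndex (uncurry blockVertex hk) ≡ hk
    index-vertex (h , zero)  = refl
    index-vertex (h , suc v) = refl
    vertex-index : ∀ c → uncurry blockVertex (blockIndex c) ≡ c
    vertex-index (hook h)   = refl
    vertex-index (pend h v) = refl

  Near : CV C → CV C → Set
  Near z c = z ≡ c ⊎ CAdj C z c

  near-pend⇒covers : ∀ {z h i} → Near z (pend h i) →
                     ∃ λ k → blockVertex h k ≡ z × Covers (ptype C h) (attach C h) k i
  near-pend⇒covers (inj₁ refl)            = suc _ , refl , inj₁ refl
  near-pend⇒covers (inj₂ (hook-pend i∈S)) = zero , refl , i∈S
  near-pend⇒covers (inj₂ (pend-pend adj)) = suc _ , refl , inj₂ adj

  covers⇒near-pend : ∀ {h k i} → Covers (ptype C h) (attach C h) k i →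
                     Near (blockVertex h k) (pend h i)
  covers⇒near-pend {k = zero}  i∈S         = inj₂ (hook-pend i∈S)
  covers⇒near-pend {k = suc v} (inj₁ refl) = inj₁ refl
  covers⇒near-pend {k = suc v} (inj₂ adj)  = inj₂ (pend-pend adj)

module Family {n m : ℕ} (G : Graph n) (C : Construction m) (f : Fin n ↔ CV C)
  (f-adj : ∀ u v → (Adj G u v ≡ true) ⇔ CAdj C (Inverse.to f u) (Inverse.to f v)) where
  open Inverse f using (to; from; strictlyInverseˡ; strictlyInverseʳ)
  open Blocks (↔-trans f (CV↔blocks C))

  cadj⇒adj : ∀ {c d} → CAdj C c d → Adj G (from c) (from d) ≡ true
  cadj⇒adj {c} {d} c~d = Equivalence.from (f-adj (from c) (from d))
    (subst₂ (CAdj C) (sym (strictlyInverseˡ c)) (sym (strictlyInverseˡ d)) c~d)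

  near⇒inClosedNbhd : ∀ {X z c} → from z ∈ X → Near C z c → InClosedNbhd G X (from c)
  near⇒inClosedNbhd z∈X (inj₁ refl) = inj₁ z∈X
  near⇒inClosedNbhd z∈X (inj₂ z~c)  = inj₂ (_ , z∈X , cadj⇒adj z~c)

  inClosedNbhd⇒near : ∀ {X c} → InClosedNbhd G X (from c) → ∃ λ z → from z ∈ X × Near C z c
  inClosedNbhd⇒near {c = c} (inj₁ c∈X) = c , c∈X , inj₁ refl
  inClosedNbhd⇒near {X} {c} (inj₂ (u , u∈X , u~c)) =
    to u , subst (_∈ X) (sym (strictlyInverseʳ u)) u∈X ,
    inj₂ (subst (CAdj C (to u)) (strictlyInverseˡ c) (Equivalence.to (f-adj u (from c)) u~c))

  pend-covered : ∀ {X h i} → InClosedNbhd G X (from (pend h i)) →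
                 ∃ λ k → k ∈ restrict X h × Covers (ptype C h) (attach C h) k i
  pend-covered x with inClosedNbhd⇒near x
  ... | z , z∈X , near with near-pend⇒covers C near
  ...   | k , refl , covers = k , ∈-restrict z∈X , covers

  isolating⇒blockIsolating : ∀ {X} → Isolating G X →
                             ∀ h → BlockIsolating (ptype C h) (attach C h) (restrict X h)
  isolating⇒blockIsolating isolating h adj with isolating _ _ (cadj⇒adj (pend-pend adj))
  ... | inj₁ covered-i = Product.map₂ (Product.map₂ inj₁) (pend-covered covered-i)
  ... | inj₂ covered-j = Product.map₂ (Product.map₂ inj₂) (pend-covered covered-j)

  γ : ℕ
  γ = ∑[ h < m ] weight (ptype C h)

  isolating⇒γ≤∣X∣ : ∀ {X} → Isolating G X → γ ≤ ∣ X ∣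
  isolating⇒γ≤∣X∣ {X} isolating = begin
    γ                            ≤⟨ ∑-mono-≤ weight≤∣restrict∣ ⟩
    ∑[ h < m ] ∣ restrict X h ∣  ≡⟨ sym (∣X∣≡∑∣restrict∣ X) ⟩
    ∣ X ∣                        ∎
    where
    open ≤-Reasoning
    weight≤∣restrict∣ : ∀ h → weight (ptype C h) ≤ ∣ restrict X h ∣
    weight≤∣restrict∣ h =
      blockIsolating⇒weight≤∣Y∣ (valid C h) (isolating⇒blockIsolating isolating h)

  anchor : (h : Fin m) → Fin (psize (ptype C h))
  anchor h = proj₁ (validAttach⇒Nonempty (valid C h))

  dominatorBlock : (h : Fin m) → Subset (blockSize C h)
  dominatorBlock h = outside ∷ pendantDominator (ptype C h) (anchor h)

  D : Subset n
  D = glue dominatorBlock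

  ∣D∣≡γ : ∣ D ∣ ≡ γ
  ∣D∣≡γ = trans (∣glue∣ dominatorBlock) (sum-cong-≗ (λ h → ∣pendantDominator∣ (ptype C h) (anchor h)))

  D-dominating : Dominating G D
  D-dominating v = subst (InClosedNbhd G D) (strictlyInverseʳ v) (dominated (to v))
    where
    dominated : ∀ c → InClosedNbhd G D (from c)
    dominated (hook h) =
      near⇒inClosedNbhd (∈-glue {dominatorBlock} (there (a∈pendantDominator (ptype C h) (anchor h))))
                        (inj₂ (pend-hook (proj₂ (validAttach⇒Nonempty (valid C h)))))
    dominated (pend h j) with pendantDominator-dominates (ptype C h) (anchor h) j
    ... | i , i∈P , near =
      near⇒inClosedNbhd (∈-glue {dominatorBlock} (there i∈P)) (covers⇒near-pend C {k = suc i} near)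

  3γ≡n : 3 * γ ≡ n
  3γ≡n = begin
    3 * γ                                ≡⟨ *-distribˡ-sum 3 (weight ∘ ptype C) ⟩
    ∑[ h < m ] (3 * weight (ptype C h))  ≡⟨ sum-cong-≗ (3*weight≡1+psize ∘ ptype C) ⟩
    sum (blockSize C)                    ≡⟨ sym n≡∑size ⟩
    n                                    ∎
    where open ≡-Reasoning

lemma4 : ∀ {n : ℕ} (G : Graph n) → In𝒢 G →
    (∃ λ γ → IsDominationNumber G γ × 3 * γ ≡ n) × (∃ λ ι → IsIsolationNumber G ι × 3 * ι ≡ n)
lemma4 G (m , C , f , f-adj) =
    (γ , ((D , D-dominating , ∣D∣≡γ) , λ X → isolating⇒γ≤∣X∣ ∘ dominating⇒isolating G) , 3γ≡n)
  , (γ , ((D , dominating⇒isolating G D-dominating , ∣D∣≡γ) , λ X → isolating⇒γ≤∣X∣) , 3γ≡n)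
  where open Family G C f f-adj
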